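{- Let $G$ be a graph with $n$ vertices and maximum degree $3$, let $S$ be any $n \times n$ grid point set, and let $\mu$ be any bijection from the vertex set of $G$ to $S$. Then $G$ admits a $\mu$-respecting restricted RAC$_2$ embedding on $S$.
   Context: An $n \times n$ grid point set is a set $S$ of $n$ points with integer coordinates in $\{1,\dots,n\}^2$ such that no two points of $S$ lie on a common horizontal or a common vertical line. A point-set embedding of $G=(V,E)$ on $S$ consists of a bijection $V \to S$ and a polyline drawing of $G$ with each vertex at its assigned point and each edge a polygonal chain between its endpoints' points; edges may not overlap (share a segment of positive length) and may not pass through points representing other vertices. It is $\mu$-respecting if the bijection used is $\mu$. A restricted RAC$_2$ embedding is such an embedding in which every bend lies on a point with integer coordinates, every edge segment is horizontal or vertical, every edge has at most two bends, and any two crossing edges cross at a right angle. The drawing is not required to stay within any bounded region (bends may lie outside $\{1,\dots,n\}^2$). -}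

module Defs where

open import Data.Nat as ℕ using (ℕ; zero; suc)
open import Data.Integer as ℤ using (ℤ; +_)
open import Data.Fin using (Fin)
open import Data.Bool using (Bool; true; false; if_then_else_)
open import Data.List using (List; []; _∷_; _++_; [_]; length; map; reverse; allFin)
open import Data.Nat.ListAction using (sum)
open import Data.List.Membership.Propositional using (_∈_)
open import Data.Product using (_×_; _,_; proj₁; proj₂; ∃)
open import Data.Sum using (_⊎_)
open import Data.Unit using (⊤)
open import Relation.Nullary using (¬_)
open import Relation.Binary.PropositionalEquality using (_≡_; _≢_)
open import Function.Bundles using (_⤖_; Bijection)

record Graph (n : ℕ) : Set where
  field
    adj   : Fin n → Fin n → Bool
    sym   : ∀ u v → adj u v ≡ adj v u
    irrefl : ∀ v → adj v v ≡ false
open Graph public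

Adj : ∀ {n} → Graph n → Fin n → Fin n → Set
Adj G u v = adj G u v ≡ true

degree : ∀ {n} → Graph n → Fin n → ℕ
degree {n} G v = sum (map (λ u → if adj G v u then 1 else 0) (allFin n))

MaxDegree≤3 : ∀ {n} → Graph n → Set
MaxDegree≤3 {n} G = ∀ v → degree G v ℕ.≤ 3

Point : Set
Point = ℤ × ℤ

xc yc : Point → ℤ
xc = proj₁
yc = proj₂

record GridPointSet (n : ℕ) : Set where
  field
    pt      : Fin n → Point
    x-range : ∀ i → (+ 1 ℤ.≤ xc (pt i)) × (xc (pt i) ℤ.≤ + n)
    y-range : ∀ i → (+ 1 ℤ.≤ yc (pt i)) × (yc (pt i) ℤ.≤ + n)
    x-inj   : ∀ i j → xc (pt i) ≡ xc (pt j) → i ≡ j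
    y-inj   : ∀ i j → yc (pt i) ≡ yc (pt j) → i ≡ j
open GridPointSet public

Segment : Set
Segment = Point × Point

Horizontal Vertical : Segment → Set
Horizontal (a , b) = yc a ≡ yc b
Vertical   (a , b) = xc a ≡ xc b

AxisSegment : Segment → Set
AxisSegment (a , b) = (a ≢ b) × (Horizontal (a , b) ⊎ Vertical (a , b))

Perpendicular : Segment → Segment → Set
Perpendicular s t = (Horizontal s × Vertical t) ⊎ (Vertical s × Horizontal t)

Between : ℤ → ℤ → ℤ → Set
Between a q b = ((a ℤ.≤ q) × (q ℤ.≤ b)) ⊎ ((b ℤ.≤ q) × (q ℤ.≤ a))

OnSeg : Point → Segment → Set
OnSeg q (a , b) =
    (xc q ≡ xc a × xc q ≡ xc b × Between (yc a) (yc q) (yc b))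
  ⊎ (yc q ≡ yc a × yc q ≡ yc b × Between (xc a) (xc q) (xc b))

-- two segments share a sub-segment of positive length
-- (for segments with integer endpoints: two distinct common integer points)
Overlap : Segment → Segment → Set
Overlap s t = ∃ λ p → ∃ λ q → (p ≢ q) × OnSeg p s × OnSeg p t × OnSeg q s × OnSeg q t

segs : List Point → List Segment
segs (a ∷ b ∷ rest) = (a , b) ∷ segs (b ∷ rest)
segs _ = []

Turns : List Point → Set
Turns (a ∷ b ∷ c ∷ rest) = Perpendicular (a , b) (b , c) × Turns (b ∷ c ∷ rest)
Turns _ = ⊤

-- Restricted RAC₂ point-set embeddings.
-- pos v is the point assigned to vertex v; route u v is the list of
-- bends of the edge uv, listed from u to v.

module _ {n : ℕ} (G : Graph n) (pos : Fin n → Point) where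

  record RestrictedRAC2 : Set where
    field
      route : Fin n → Fin n → List Point
    path : Fin n → Fin n → List Point
    path u v = pos u ∷ route u v ++ [ pos v ]
    field
      -- the drawing of edge uv is the same polyline traversed from either end
      route-sym  : ∀ u v → Adj G u v → route v u ≡ reverse (route u v)
      two-bends  : ∀ u v → Adj G u v → length (route u v) ℕ.≤ 2
      axis       : ∀ u v → Adj G u v → ∀ s → s ∈ segs (path u v) → AxisSegment s
      genuine    : ∀ u v → Adj G u v → Turns (path u v)
      avoid      : ∀ u v → Adj G u v → ∀ w → w ≢ u → w ≢ v →
                   ∀ s → s ∈ segs (path u v) → ¬ OnSeg (pos w) s
      no-overlap : ∀ u v u' v' → Adj G u v → Adj G u' v' →
                   ¬ ((u ≡ u' × v ≡ v') ⊎ (u ≡ v' × v ≡ u')) →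
                   ∀ s t → s ∈ segs (path u v) → t ∈ segs (path u' v') →
                   ¬ Overlap s t
      right-angle : ∀ u v u' v' → Adj G u v → Adj G u' v' →
                   ¬ ((u ≡ u' × v ≡ v') ⊎ (u ≡ v' × v ≡ u')) →
                   ∀ s t → s ∈ segs (path u v) → t ∈ segs (path u' v') →
                   ∀ q → OnSeg q s → OnSeg q t → (∀ w → pos w ≢ q) →
                   Perpendicular s t

MuRespectingRAC2 : ∀ {n} → Graph n → (S : GridPointSet n) → (Fin n ⤖ Fin n) → Set
MuRespectingRAC2 G S μ = RestrictedRAC2 G (λ v → pt S (Bijection.to μ v))

module Submission where

-- A graph of maximum degree 3 has a proper edge colouring with four colours: delete a vertex,
-- colour the rest by induction, and give the at most three edges at the deleted vertex distinct
-- colours missing at their other ends; when the missing colours leave no such choice, an α/γ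
-- Kempe chain swap creates one.
--
-- The four colours are the four directions. An edge uv coloured "up" leaves u and v vertically
-- upwards, and the two legs are joined by a horizontal bridge at height n + min(x u, x v), above
-- all points of S; the other colours are rotations of this. Each edge thus has two bends, its legs
-- lie on the grid lines through its endpoints, and its bridge lies outside the grid. Two edges of
-- the same colour share no endpoint, so as the coordinates of S are distinct, their bridges are at
-- different levels and their legs on different lines. Hence two pieces of distinct edges are either
-- perpendicular, on distinct parallel lines, or opposite legs at a common vertex.

open import Defs hiding (sym)
open import Algebra.Bundles using (AbelianGroup)
open import Data.Bool using (true; if_then_else_)
import Data.Bool.Properties as Boolₚ
open import Data.Empty using (⊥; ⊥-elim)
open import Data.Fin using (Fin; zero; suc; toℕ; fromℕ<)
import Data.Fin.Properties as Finₚ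
open import Data.Integer as ℤ using (ℤ; +_; -_; _⊓_)
import Data.Integer.Properties as ℤP
open import Data.List using (List; []; _∷_; _++_; [_]; map; filter; tabulate; allFin; length; reverse)
open import Data.List.Properties using (map-tabulate; length-map)
open import Data.List.Membership.Propositional using (_∈_)
import Data.List.Membership.Propositional.Properties as ∈ₚ
open import Data.List.Relation.Unary.All as All using (All; []; _∷_)
import Data.List.Relation.Unary.All.Properties as Allₚ
open import Data.List.Relation.Unary.AllPairs using ([]; _∷_)
open import Data.List.Relation.Unary.Any using (here; there)
open import Data.List.Relation.Unary.Any.Properties using (¬Any[])
open import Data.List.Relation.Unary.Unique.Propositional using (Unique)
import Data.List.Relation.Unary.Unique.Propositional.Properties as Uniqueₚ
open import Data.Maybe using (Maybe; just; nothing; _>>=_; fromMaybe)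
import Data.Maybe.Properties as Maybeₚ
open import Data.Nat as ℕ using (ℕ; zero; suc; _+_; _≤_; _<_; z≤n; s≤s)
open import Data.Nat.ListAction using (sum)
import Data.Nat.Properties as ℕP
open import Data.Product using (_×_; _,_; proj₁; proj₂; ∃-syntax; Σ-syntax; uncurry)
import Data.Product.Properties as Productₚ
open import Data.Sum as Sum using (_⊎_; inj₁; inj₂)
open import Data.Unit using (tt)
open import Data.Vec.Functional using (updateAt)
open import Data.Vec.Functional.Properties using (updateAt-minimal)
open import Function using (const; id; _∘_)
open import Function.Bundles using (_⤖_; Bijection)
open import Relation.Nullary using (¬_; Dec; yes; no; _×-dec_)
open import Relation.Binary.Definitions using (DecidableEquality; tri<; tri≈; tri>)
open import Relation.Binary.PropositionalEquality hiding ([_])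

open import Algebra.Properties.CommutativeSemigroup ℕP.+-commutativeSemigroup using (x∙yz≈y∙xz)
open import Algebra.Properties.Group (AbelianGroup.group ℤP.+-0-abelianGroup) using (∙-cancelˡ)

-- Degree counting

sum-tabulate-updateAt : ∀ {n} (g : Fin n → ℕ) i →
  sum (tabulate g) ≡ g i + sum (tabulate (updateAt g i (const 0)))
sum-tabulate-updateAt {suc n} g zero    = refl
sum-tabulate-updateAt {suc n} g (suc i) = begin
  g zero + sum (tabulate (g ∘ suc))
    ≡⟨ cong (λ t → g zero + t) (sum-tabulate-updateAt (g ∘ suc) i) ⟩
  g zero + (g (suc i) + sum (tabulate (updateAt (g ∘ suc) i (const 0))))
    ≡⟨ x∙yz≈y∙xz (g zero) (g (suc i)) _ ⟩
  g (suc i) + (g zero + sum (tabulate (updateAt (g ∘ suc) i (const 0))))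
    ∎
  where open ≡-Reasoning

length≤sum-tabulate : ∀ {n} (g : Fin n → ℕ) (xs : List (Fin n)) → Unique xs →
  All (λ i → 1 ≤ g i) xs → length xs ≤ sum (tabulate g)
length≤sum-tabulate g []       _              _            = z≤n
length≤sum-tabulate g (x ∷ xs) (x∉xs ∷ uniq) (gx≥1 ∷ gxs≥1) =
  subst (1 + length xs ≤_) (sym (sum-tabulate-updateAt g x))
    (ℕP.+-mono-≤ gx≥1 (length≤sum-tabulate g′ xs uniq (All.zipWith unchanged (x∉xs , gxs≥1))))
  where
  g′ = updateAt g x (const 0)
  unchanged : ∀ {i} → x ≢ i × 1 ≤ g i → 1 ≤ g′ i
  unchanged {i} (x≢i , gi≥1) = subst (1 ≤_) (sym (updateAt-minimal i x g (x≢i ∘ sym))) gi≥1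

Subcubic : ∀ {n} → Graph n → Set
Subcubic {n} G = ∀ v (xs : List (Fin n)) → Unique xs → All (Adj G v) xs → length xs ≤ 3

maxDegree≤3⇒subcubic : ∀ {n} (G : Graph n) → MaxDegree≤3 G → Subcubic G
maxDegree≤3⇒subcubic {n} G Δ≤3 v xs uniq adjs = ℕP.≤-trans
  (length≤sum-tabulate indicator xs uniq (All.map adjacent⇒1≤ adjs))
  (subst (_≤ 3) (cong sum (map-tabulate id indicator)) (Δ≤3 v))
  where
  indicator : Fin n → ℕ
  indicator u = if adj G v u then 1 else 0
  adjacent⇒1≤ : ∀ {u} → Adj G v u → 1 ≤ indicator u
  adjacent⇒1≤ vu rewrite vu = s≤s z≤n

-- Edge colourings and Kempe chains

Adj-sym : ∀ {n} (G : Graph n) {u v} → Adj G u v → Adj G v u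
Adj-sym G {u} {v} uv = trans (Graph.sym G v u) uv

Adj-irrefl : ∀ {n} (G : Graph n) {u v} → Adj G u v → u ≢ v
Adj-irrefl G {u} uu refl with trans (sym uu) (irrefl G u)
... | ()

record EdgeColouring {n} (G : Graph n) (K : Set) : Set where
  field
    colour     : Fin n → Fin n → K
    colour-sym : ∀ u v → Adj G u v → colour u v ≡ colour v u
    proper     : ∀ u v w → Adj G u v → Adj G u w → colour u v ≡ colour u w → v ≡ w
open EdgeColouring

module _ {n} {G : Graph n} {K : Set} where

  Used Missing : EdgeColouring G K → Fin n → K → Set
  Used C x p = ∃[ y ] Adj G x y × colour C x y ≡ p
  Missing C x p = ¬ Used C x p

  used? : DecidableEquality K → (C : EdgeColouring G K) → ∀ x p → Dec (Used C x p)
  used? _≟_ C x p = Finₚ.any? λ y → (adj G x y Boolₚ.≟ true) ×-dec (colour C x y ≟ p)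

  colour-flip : (C : EdgeColouring G K) → ∀ {u v p} → Adj G u v → colour C u v ≡ p → colour C v u ≡ p
  colour-flip C {u} {v} uv e = trans (sym (colour-sym C u v uv)) e

SameEdge : ∀ {n} → Fin n → Fin n → Fin n → Fin n → Set
SameEdge u v u′ v′ = (u ≡ u′ × v ≡ v′) ⊎ (u ≡ v′ × v ≡ u′)

Ends : ∀ {n} → Fin n → Fin n → Fin n → Set
Ends u v w = w ≡ u ⊎ w ≡ v

module _ {n} {G : Graph n} {K : Set} (C : EdgeColouring G K) where

  shared-endpoint⇒colours-differ : ∀ {u v u′ v′ w} → Adj G u v → Adj G u′ v′ → ¬ SameEdge u v u′ v′ →
                                   Ends u v w → Ends u′ v′ w → colour C u v ≢ colour C u′ v′
  shared-endpoint⇒colours-differ {u} {v} {u′} {v′} uv u′v′ ¬same (inj₁ refl) (inj₁ refl) e =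
    ¬same (inj₁ (refl , proper C u v v′ uv u′v′ e))
  shared-endpoint⇒colours-differ {u} {v} {u′} {v′} uv u′v′ ¬same (inj₁ refl) (inj₂ refl) e =
    ¬same (inj₂ (refl , proper C u v u′ uv (Adj-sym G u′v′) (trans e (colour-sym C u′ v′ u′v′))))
  shared-endpoint⇒colours-differ {u} {v} {u′} {v′} uv u′v′ ¬same (inj₂ refl) (inj₁ refl) e =
    ¬same (inj₂ (proper C v u v′ (Adj-sym G uv) u′v′ (trans (sym (colour-sym C u v uv)) e) , refl))
  shared-endpoint⇒colours-differ {u} {v} {u′} {v′} uv u′v′ ¬same (inj₂ refl) (inj₂ refl) e =
    ¬same (inj₁ (proper C v u u′ (Adj-sym G uv) (Adj-sym G u′v′)
                   (trans (sym (colour-sym C u v uv)) (trans e (colour-sym C u′ v′ u′v′))) , refl))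

module _ {K : Set} (_≟_ : DecidableEquality K) (α γ : K) where

  transpose : K → K
  transpose p with p ≟ α
  ... | yes _ = γ
  ... | no _ with p ≟ γ
  ...   | yes _ = α
  ...   | no _ = p

  transpose-α : transpose α ≡ γ
  transpose-α with α ≟ α
  ... | yes _ = refl
  ... | no α≢α = ⊥-elim (α≢α refl)

  transpose-γ : transpose γ ≡ α
  transpose-γ with γ ≟ α
  ... | yes γ≡α = γ≡α
  ... | no _ with γ ≟ γ
  ...   | yes _ = refl
  ...   | no γ≢γ = ⊥-elim (γ≢γ refl)

  transpose-fix : ∀ {p} → p ≢ α → p ≢ γ → transpose p ≡ p
  transpose-fix {p} p≢α p≢γ with p ≟ α
  ... | yes p≡α = ⊥-elim (p≢α p≡α)
  ... | no _ with p ≟ γ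
  ...   | yes p≡γ = ⊥-elim (p≢γ p≡γ)
  ...   | no _ = refl

  transpose-involutive : ∀ p → transpose (transpose p) ≡ p
  transpose-involutive p with p ≟ α
  ... | yes refl = transpose-γ
  ... | no p≢α with p ≟ γ
  ...   | yes refl = transpose-α
  ...   | no p≢γ = transpose-fix p≢α p≢γ

  transpose-injective : ∀ {p q} → transpose p ≡ transpose q → p ≡ q
  transpose-injective {p} {q} e = begin
    p                         ≡⟨ transpose-involutive p ⟨
    transpose (transpose p)   ≡⟨ cong transpose e ⟩
    transpose (transpose q)   ≡⟨ transpose-involutive q ⟩
    q                         ∎
    where open ≡-Reasoning

double : ℕ → ℕ
double zero    = zero
double (suc d) = suc (suc (double d))

even⊎odd : ∀ k → (∃[ d ] k ≡ double d) ⊎ (∃[ d ] k ≡ suc (double d))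
even⊎odd zero = inj₁ (0 , refl)
even⊎odd (suc k) with even⊎odd k
... | inj₁ (d , refl) = inj₂ (d , refl)
... | inj₂ (d , refl) = inj₁ (suc d , refl)

module KempeChain {n} {G : Graph n} {K : Set} (_≟_ : DecidableEquality K) (C : EdgeColouring G K)
                  (a : Fin n) (α γ : K) (a-misses-α : Missing C a α) where

  chainColour : ℕ → K
  chainColour zero          = γ
  chainColour (suc zero)    = α
  chainColour (suc (suc i)) = chainColour i

  chainColour-alternates : ∀ i → (chainColour i ≡ γ × chainColour (suc i) ≡ α)
                               ⊎ (chainColour i ≡ α × chainColour (suc i) ≡ γ)
  chainColour-alternates zero          = inj₁ (refl , refl)
  chainColour-alternates (suc zero)    = inj₂ (refl , refl)
  chainColour-alternates (suc (suc i)) = chainColour-alternates i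

  chainColour-periodic : ∀ d i → chainColour (double d + i) ≡ chainColour i
  chainColour-periodic zero    i = refl
  chainColour-periodic (suc d) i = chainColour-periodic d i

  chainColour-periodic′ : ∀ d i → chainColour (suc (double d + i)) ≡ chainColour (suc i)
  chainColour-periodic′ d i = trans (cong chainColour (sym (ℕP.+-suc (double d) i))) (chainColour-periodic d (suc i))

  follow : Fin n → K → Maybe (Fin n)
  follow x p with used? _≟_ C x p
  ... | yes (y , _) = just y
  ... | no _        = nothing

  follow-sound : ∀ {x p y} → follow x p ≡ just y → Adj G x y × colour C x y ≡ p
  follow-sound {x} {p} e with used? _≟_ C x p
  follow-sound refl | yes (_ , xy) = xy

  follow-complete : ∀ {x p y} → Adj G x y → colour C x y ≡ p → follow x p ≡ just y
  follow-complete {x} {p} {y} xy c with used? _≟_ C x p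
  ... | yes (y′ , xy′ , c′) = cong just (proper C x y′ y xy′ xy (trans c′ (sym c)))
  ... | no missing          = ⊥-elim (missing (y , xy , c))

  walk : ℕ → Maybe (Fin n)
  walk zero    = just a
  walk (suc i) = walk i >>= λ x → follow x (chainColour i)

  walk-pred : ∀ i {y} → walk (suc i) ≡ just y →
              ∃[ x ] walk i ≡ just x × Adj G x y × colour C x y ≡ chainColour i
  walk-pred i e with walk i
  walk-pred i () | nothing
  walk-pred i e  | just x = x , refl , follow-sound e

  walk-next : ∀ i {x y} → walk i ≡ just x → Adj G x y → colour C x y ≡ chainColour i →
              walk (suc i) ≡ just y
  walk-next i e xy c rewrite e = follow-complete xy c

  walk-prefix : ∀ i j {y} → i ≤ j → walk j ≡ just y → ∃[ x ] walk i ≡ just x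
  walk-prefix i j i≤j e with ℕP.m≤n⇒m<n∨m≡n i≤j
  walk-prefix i j       i≤j e | inj₂ refl           = _ , e
  walk-prefix i (suc j) i≤j e | inj₁ (s≤s i≤j′) = walk-prefix i j i≤j′ (proj₁ (proj₂ (walk-pred j e)))

  arrival : ∀ j {x} → walk (suc j) ≡ just x →
            ∃[ z ] walk j ≡ just z × Adj G x z × colour C x z ≡ chainColour j
  arrival j e = let z , wz , zx , c = walk-pred j e in z , wz , Adj-sym G zx , colour-flip C zx c

  departure : ∀ i {x y} → walk i ≡ just x → walk (suc i) ≡ just y →
              Adj G x y × colour C x y ≡ chainColour i
  departure i wx wy with walk-pred i wy
  ... | x′ , wx′ , xy with Maybeₚ.just-injective (trans (sym wx′) wx)
  ...   | refl = xy

  -- A step of the walk is determined by properness from either end, so a return at odd distance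
  -- shrinks to a loop, and one at even distance traces back to a, which misses α.
  no-odd-return : ∀ d i {x} → walk i ≡ just x → walk (suc (double d + i)) ≡ just x → ⊥
  no-odd-return zero    i wx wx′ = Adj-irrefl G (proj₁ (departure i wx wx′)) refl
  no-odd-return (suc d) i {x} wx wx′
    with walk-prefix (suc i) _ (s≤s (ℕP.m≤n+m i (suc (suc (double d))))) wx′
  ... | y , wy with arrival (suc (suc (double d + i))) wx′ | departure i wx wy
  ...   | z , wz , xz , cz | xy , cy =
    no-odd-return d (suc i) wy (subst (λ k → walk k ≡ just y) (cong suc (sym (ℕP.+-suc (double d) i))) wz′)
    where
    wz′ : walk (suc (suc (double d + i))) ≡ just y
    wz′ = subst (λ w → _ ≡ just w) (proper C x z y xz xy (trans cz (trans (chainColour-periodic d i) (sym cy)))) wz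

  no-even-return : ∀ i d {x} → walk i ≡ just x → walk (double (suc d) + i) ≡ just x → ⊥
  no-even-return zero d refl wa with arrival (suc (double d + 0)) wa
  ... | z , _ , az , c = a-misses-α (z , az , trans c (chainColour-periodic′ d 0))
  no-even-return (suc i) d {x} wx wx′ with arrival i wx | arrival (suc (double d + suc i)) wx′
  ... | z , wz , xz , c | z′ , wz′ , xz′ , c′ =
    no-even-return i d wz (subst (λ k → walk k ≡ just z) (cong suc (ℕP.+-suc (double d) i)) wz″)
    where
    wz″ : walk (suc (double d + suc i)) ≡ just z
    wz″ = subst (λ w → _ ≡ just w)
            (proper C x z′ z xz′ xz (trans c′ (trans (chainColour-periodic′ d (suc i)) (sym c)))) wz′

  walk-loop-free : ∀ {i j x} → i < j → walk i ≡ just x → walk j ≡ just x → ⊥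
  walk-loop-free {i} {j} {x} i<j wi wj with ℕP.m≤n⇒∃[o]m+o≡n i<j
  ... | o , refl with even⊎odd o | subst (λ k → walk (suc k) ≡ just x) (ℕP.+-comm i o) wj
  ...   | inj₁ (d , refl) | wj′ = no-odd-return d i wi wj′
  ...   | inj₂ (d , refl) | wj′ = no-even-return i d wi wj′

  no-walk-of-length-n : ∀ {x} → walk n ≡ just x → ⊥
  no-walk-of-length-n wₙ with Finₚ.pigeonhole (ℕP.n<1+n n) vertexAt
    where
    vertexAt : Fin (suc n) → Fin n
    vertexAt k = fromMaybe a (walk (toℕ k))
  ... | k , k′ , k<k′ , same = walk-loop-free k<k′ (defined k) (trans (defined k′) (cong just (sym same)))
    where
    defined : ∀ k → walk (toℕ k) ≡ just (fromMaybe a (walk (toℕ k)))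
    defined k with walk-prefix (toℕ k) n (ℕP.≤-pred (Finₚ.toℕ<n k)) wₙ
    ... | _ , wk rewrite wk = refl

  walk-length : ∀ i {x} → walk i ≡ just x → i < n
  walk-length i wi with i ℕ.<? n
  ... | yes i<n = i<n
  ... | no i≮n = ⊥-elim (no-walk-of-length-n (proj₂ (walk-prefix n i (ℕP.≮⇒≥ i≮n) wi)))

  InChain : Fin n → Set
  InChain x = ∃[ k ] walk (toℕ {n} k) ≡ just x

  inChain? : ∀ x → Dec (InChain x)
  inChain? x = Finₚ.any? λ k → Maybeₚ.≡-dec Finₚ._≟_ (walk (toℕ k)) (just x)

  reached⇒inChain : ∀ i {x} → walk i ≡ just x → InChain x
  reached⇒inChain i wi =
    fromℕ< (walk-length i wi) , subst (λ k → walk k ≡ _) (sym (Finₚ.toℕ-fromℕ< (walk-length i wi))) wi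

  chainColour-cases : ∀ i {p} → p ≡ α ⊎ p ≡ γ → p ≡ chainColour i ⊎ p ≡ chainColour (suc i)
  chainColour-cases i p∈αγ with chainColour-alternates i | p∈αγ
  ... | inj₁ (_ , c′) | inj₁ p≡α = inj₂ (trans p≡α (sym c′))
  ... | inj₁ (c , _)  | inj₂ p≡γ = inj₁ (trans p≡γ (sym c))
  ... | inj₂ (c , _)  | inj₁ p≡α = inj₁ (trans p≡α (sym c))
  ... | inj₂ (_ , c′) | inj₂ p≡γ = inj₂ (trans p≡γ (sym c′))

  chain-closed-at : ∀ i {x y} → walk i ≡ just x → Adj G x y →
                    colour C x y ≡ α ⊎ colour C x y ≡ γ → InChain y
  chain-closed-at i wx xy c with chainColour-cases i c
  ... | inj₁ c′ = reached⇒inChain (suc i) (walk-next i wx xy c′)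
  chain-closed-at zero    refl xy c | inj₂ c′ = ⊥-elim (a-misses-α (_ , xy , c′))
  chain-closed-at (suc i) wx   xy c | inj₂ c′ with arrival i wx
  ... | z , wz , xz , cz =
    reached⇒inChain i (subst (λ w → walk i ≡ just w) (proper C _ z _ xz xy (trans cz (sym c′))) wz)

  chain-closed : ∀ {x y} → InChain x → Adj G x y → InChain y ⊎ (colour C x y ≢ α × colour C x y ≢ γ)
  chain-closed {x} {y} (k , wx) xy with colour C x y ≟ α | colour C x y ≟ γ
  ... | yes c | _     = inj₁ (chain-closed-at (toℕ k) wx xy (inj₁ c))
  ... | no _  | yes c = inj₁ (chain-closed-at (toℕ k) wx xy (inj₂ c))
  ... | no c  | no c′ = inj₂ (c , c′)

  walk-stops-at-α-missing : ∀ i {x y} → walk (suc i) ≡ just x → Missing C x α →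
                            walk (suc (suc i)) ≡ just y → ⊥
  walk-stops-at-α-missing i wx miss wy with chainColour-alternates i
  ... | inj₁ (_ , c) = let xy , cy = departure (suc i) wx wy in miss (_ , xy , trans cy c)
  ... | inj₂ (c , _) = let z , _ , xz , cz = arrival i wx in miss (z , xz , trans cz c)

  at-most-one-α-end : ∀ {b c} → b ≢ a → c ≢ a → b ≢ c → Missing C b α → Missing C c α →
                      InChain b → InChain c → ⊥
  at-most-one-α-end {b} {c} b≢a c≢a b≢c mb mc (k , wb) (k′ , wc) = go (toℕ k) (toℕ k′) wb wc
    where
    go : ∀ i j → walk i ≡ just b → walk j ≡ just c → ⊥
    go zero    _       refl _    = b≢a refl
    go (suc i) zero    _    refl = c≢a refl
    go (suc i) (suc j) wb wc with ℕP.<-cmp i j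
    ... | tri≈ _ refl _ = b≢c (Maybeₚ.just-injective (trans (sym wb) wc))
    ... | tri< i<j _ _ = walk-stops-at-α-missing i wb mb (proj₂ (walk-prefix (suc (suc i)) (suc j) (s≤s i<j) wc))
    ... | tri> _ _ j<i = walk-stops-at-α-missing j wc mc (proj₂ (walk-prefix (suc (suc j)) (suc i) (s≤s j<i) wb))

  τ : K → K
  τ = transpose _≟_ α γ

  recolour : Fin n → Fin n → K
  recolour x y with inChain? x
  ... | yes _ = τ (colour C x y)
  ... | no _  = colour C x y

  recolour-sym : ∀ u v → Adj G u v → recolour u v ≡ recolour v u
  recolour-sym u v uv with inChain? u | inChain? v
  ... | yes _  | yes _  = cong τ (colour-sym C u v uv)
  ... | no _   | no _   = colour-sym C u v uv
  ... | yes u∈ | no v∉ with chain-closed u∈ uv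
  ...   | inj₁ v∈ = ⊥-elim (v∉ v∈)
  ...   | inj₂ (c≢α , c≢γ) = trans (transpose-fix _≟_ α γ c≢α c≢γ) (colour-sym C u v uv)
  recolour-sym u v uv | no u∉ | yes v∈ with chain-closed v∈ (Adj-sym G uv)
  ...   | inj₁ u∈ = ⊥-elim (u∉ u∈)
  ...   | inj₂ (c≢α , c≢γ) = sym (trans (transpose-fix _≟_ α γ c≢α c≢γ) (colour-sym C v u (Adj-sym G uv)))

  recolour-proper : ∀ u v w → Adj G u v → Adj G u w → recolour u v ≡ recolour u w → v ≡ w
  recolour-proper u v w uv uw e with inChain? u
  ... | yes _ = proper C u v w uv uw (transpose-injective _≟_ α γ e)
  ... | no _  = proper C u v w uv uw e

  swapped : EdgeColouring G K
  swapped = record { colour = recolour ; colour-sym = recolour-sym ; proper = recolour-proper }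

  a-misses-γ : Missing swapped a γ
  a-misses-γ (y , ay , c) with inChain? a
  ... | yes _  = a-misses-α (y , ay , trans (sym (transpose-involutive _≟_ α γ (colour C a y)))
                                            (trans (cong τ c) (transpose-γ _≟_ α γ)))
  ... | no a∉ = a∉ (reached⇒inChain 0 refl)

  missing-preserved : ∀ {x p} → p ≢ α → p ≢ γ → Missing C x p → Missing swapped x p
  missing-preserved {x} {p} p≢α p≢γ miss (y , xy , c) with inChain? x
  ... | yes _ = miss (y , xy , trans (sym (transpose-involutive _≟_ α γ (colour C x y)))
                                     (trans (cong τ c) (transpose-fix _≟_ α γ p≢α p≢γ)))
  ... | no _  = miss (y , xy , c)

  α-missing-preserved : ∀ {x} → ¬ InChain x → Missing C x α → Missing swapped x α
  α-missing-preserved {x} x∉ miss (y , xy , c) with inChain? x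
  ... | yes x∈ = x∉ x∈
  ... | no _   = miss (y , xy , c)

kempe-swap : ∀ {n} {G : Graph n} {K : Set} → DecidableEquality K → (C : EdgeColouring G K) →
  ∀ {a b c α γ} → Missing C a α → b ≢ a → c ≢ a → b ≢ c → Missing C b α → Missing C c α →
  Σ[ C′ ∈ EdgeColouring G K ] Missing C′ a γ
    × (∀ {x p} → p ≢ α → p ≢ γ → Missing C x p → Missing C′ x p)
    × (Missing C′ b α ⊎ Missing C′ c α)
kempe-swap _≟_ C {a} {b} {c} {α} {γ} a-misses-α b≢a c≢a b≢c mb mc =
  swapped , a-misses-γ , missing-preserved , survivor
  where
  open KempeChain _≟_ C a α γ a-misses-α
  survivor : Missing swapped b α ⊎ Missing swapped c α
  survivor = pick (inChain? b) (inChain? c)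
    where
    pick : Dec (InChain b) → Dec (InChain c) → Missing swapped b α ⊎ Missing swapped c α
    pick (no b∉)  _        = inj₁ (α-missing-preserved b∉ mb)
    pick (yes _)  (no c∉)  = inj₂ (α-missing-preserved c∉ mc)
    pick (yes b∈) (yes c∈) = ⊥-elim (at-most-one-α-end b≢a c≢a b≢c mb mc b∈ c∈)

-- Proper 4-edge-colourings of subcubic graphs

data Axis : Set where
  horizontal vertical : Axis

data Side : Set where
  low high : Side

-- The colour (a , s) draws an edge with both legs along axis a, towards side s, and the bridge
-- beyond the grid on side s.
Port : Set
Port = Axis × Side

pattern up    = vertical , high
pattern down  = vertical , low
pattern left  = horizontal , low
pattern right = horizontal , high

_≟ᵃ_ : DecidableEquality Axis
horizontal ≟ᵃ horizontal = yes refl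
horizontal ≟ᵃ vertical   = no λ ()
vertical   ≟ᵃ horizontal = no λ ()
vertical   ≟ᵃ vertical   = yes refl

_≟ˢ_ : DecidableEquality Side
low  ≟ˢ low  = yes refl
low  ≟ˢ high = no λ ()
high ≟ˢ low  = no λ ()
high ≟ˢ high = yes refl

_≟ᵖ_ : DecidableEquality Port
_≟ᵖ_ = Productₚ.≡-dec _≟ᵃ_ _≟ˢ_

perp : Axis → Axis
perp horizontal = vertical
perp vertical   = horizontal

perp-≢ : ∀ a → perp a ≢ a
perp-≢ horizontal ()
perp-≢ vertical   ()

opposite : Side → Side
opposite low  = high
opposite high = low

opposite-≢ : ∀ s → opposite s ≢ s
opposite-≢ low  ()
opposite-≢ high ()

third-port : ∀ (p q : Port) → ∃[ r ] r ≢ p × r ≢ q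
third-port (a , s) (b , t) with a ≟ᵃ b
... | yes refl = (perp a , s) , (λ e → perp-≢ a (cong proj₁ e)) , (λ e → perp-≢ a (cong proj₁ e))
... | no a≢b   = (a , opposite s) , (λ e → opposite-≢ s (cong proj₂ e)) , (λ e → a≢b (cong proj₁ e))

module _ {n} {G : Graph n} where

  TwoMissing : EdgeColouring G Port → Fin n → Set
  TwoMissing C x = ∃[ p ] ∃[ q ] p ≢ q × Missing C x p × Missing C x q

  two-missing : (C : EdgeColouring G Port) → ∀ x →
    (∀ {p q r} → p ≢ q → p ≢ r → q ≢ r → Used C x p → Used C x q → Used C x r → ⊥) → TwoMissing C x
  two-missing C x no-three
    with used? _≟ᵖ_ C x up | used? _≟ᵖ_ C x down | used? _≟ᵖ_ C x left | used? _≟ᵖ_ C x right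
  ... | no mu  | no md  | _      | _      = up , down , (λ ()) , mu , md
  ... | no mu  | yes _  | no ml  | _      = up , left , (λ ()) , mu , ml
  ... | no mu  | yes _  | yes _  | no mr  = up , right , (λ ()) , mu , mr
  ... | no _   | yes ud | yes ul | yes ur = ⊥-elim (no-three (λ ()) (λ ()) (λ ()) ud ul ur)
  ... | yes _  | no md  | no ml  | _      = down , left , (λ ()) , md , ml
  ... | yes _  | no md  | yes _  | no mr  = down , right , (λ ()) , md , mr
  ... | yes uu | no _   | yes ul | yes ur = ⊥-elim (no-three (λ ()) (λ ()) (λ ()) uu ul ur)
  ... | yes _  | yes _  | no ml  | no mr  = left , right , (λ ()) , ml , mr
  ... | yes uu | yes ud | yes ul | _      = ⊥-elim (no-three (λ ()) (λ ()) (λ ()) uu ud ul)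
  ... | yes uu | yes ud | no _   | yes ur = ⊥-elim (no-three (λ ()) (λ ()) (λ ()) uu ud ur)

  missing-avoiding : (C : EdgeColouring G Port) → ∀ {x} → TwoMissing C x → ∀ p →
                     ∃[ r ] Missing C x r × r ≢ p
  missing-avoiding C (q , r , q≢r , mq , mr) p with q ≟ᵖ p
  ... | yes refl = r , mr , (λ e → q≢r (sym e))
  ... | no q≢p   = q , mq , q≢p

  used≢missing : (C : EdgeColouring G Port) → ∀ {x p q} → Used C x p → Missing C x q → p ≢ q
  used≢missing C u m refl = m u

delete₀ : ∀ {n} → Graph (suc n) → Graph n
delete₀ G = record
  { adj    = λ i j → adj G (suc i) (suc j)
  ; sym    = λ i j → Graph.sym G (suc i) (suc j)
  ; irrefl = λ i → irrefl G (suc i)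
  }

suc-unique : ∀ {n} {xs : List (Fin n)} → Unique xs → Unique (map suc xs)
suc-unique = Uniqueₚ.map⁺ Finₚ.suc-injective

delete₀-subcubic : ∀ {n} (G : Graph (suc n)) → Subcubic G → Subcubic (delete₀ G)
delete₀-subcubic G sub v xs uniq adjs =
  subst (_≤ 3) (length-map suc xs) (sub (suc v) (map suc xs) (suc-unique uniq) (Allₚ.map⁺ adjs))

module Extension {n} (G : Graph (suc n)) (sub : Subcubic G) where

  G′ : Graph n
  G′ = delete₀ G

  N : Fin n → Set
  N j = Adj G zero (suc j)

  two-missing-at-neighbour : (C : EdgeColouring G′ Port) → ∀ {x} → N x → TwoMissing C x
  two-missing-at-neighbour C {x} nx = two-missing C x no-three
    where
    no-three : ∀ {p q r} → p ≢ q → p ≢ r → q ≢ r → Used C x p → Used C x q → Used C x r → ⊥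
    no-three p≢q p≢r q≢r (y₁ , xy₁ , c₁) (y₂ , xy₂ , c₂) (y₃ , xy₃ , c₃)
      with sub (suc x) (zero ∷ suc y₁ ∷ suc y₂ ∷ suc y₃ ∷ [])
             (((λ ()) ∷ (λ ()) ∷ (λ ()) ∷ [])
                ∷ (ends-differ c₁ c₂ p≢q ∷ ends-differ c₁ c₃ p≢r ∷ [])
                ∷ (ends-differ c₂ c₃ q≢r ∷ []) ∷ [] ∷ [])
             (Adj-sym G nx ∷ xy₁ ∷ xy₂ ∷ xy₃ ∷ [])
      where
      ends-differ : ∀ {y y′ p p′} → colour C x y ≡ p → colour C x y′ ≡ p′ → p ≢ p′ → suc y ≢ suc y′
      ends-differ c c′ p≢p′ e = p≢p′ (trans (sym c) (trans (cong (colour C x) (Finₚ.suc-injective e)) c′))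
    ... | s≤s (s≤s (s≤s ()))

  extend : (C : EdgeColouring G′ Port) (f : Fin n → Port) →
           (∀ j → N j → Missing C j (f j)) → (∀ j k → N j → N k → f j ≡ f k → j ≡ k) →
           EdgeColouring G Port
  extend C f f-missing f-injective =
    record { colour = colourᴳ ; colour-sym = colourᴳ-sym ; proper = colourᴳ-proper }
    where
    colourᴳ : Fin (suc n) → Fin (suc n) → Port
    colourᴳ zero    zero    = up  -- never used: 0 is not adjacent to itself
    colourᴳ zero    (suc j) = f j
    colourᴳ (suc i) zero    = f i
    colourᴳ (suc i) (suc j) = colour C i j

    colourᴳ-sym : ∀ u v → Adj G u v → colourᴳ u v ≡ colourᴳ v u
    colourᴳ-sym zero    zero    _  = refl
    colourᴳ-sym zero    (suc j) _  = refl
    colourᴳ-sym (suc i) zero    _  = refl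
    colourᴳ-sym (suc i) (suc j) ij = colour-sym C i j ij

    colourᴳ-proper : ∀ u v w → Adj G u v → Adj G u w → colourᴳ u v ≡ colourᴳ u w → v ≡ w
    colourᴳ-proper zero    zero    _       uv _  _ = ⊥-elim (Adj-irrefl G uv refl)
    colourᴳ-proper zero    (suc _) zero    _  uw _ = ⊥-elim (Adj-irrefl G uw refl)
    colourᴳ-proper zero    (suc j) (suc k) uv uw e = cong suc (f-injective j k uv uw e)
    colourᴳ-proper (suc i) zero    zero    _  _  _ = refl
    colourᴳ-proper (suc i) zero    (suc k) uv uw e = ⊥-elim (f-missing i (Adj-sym G uv) (k , uw , sym e))
    colourᴳ-proper (suc i) (suc j) zero    uv uw e = ⊥-elim (f-missing i (Adj-sym G uw) (j , uv , e))
    colourᴳ-proper (suc i) (suc j) (suc k) uv uw e = cong suc (proper C i j k uv uw e)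

  -- Colours for the edges 0a, 0b, 0c; the implications in place of inequalities allow a, b, c to
  -- repeat when vertex 0 has fewer than three neighbours.
  record Choice (C : EdgeColouring G′ Port) (a b c : Fin n) : Set where
    field
      pa pb pc       : Port
      a-misses       : Missing C a pa
      b-misses       : Missing C b pb
      c-misses       : Missing C c pc
      pa≡pb⇒a≡b     : pa ≡ pb → a ≡ b
      pa≡pc⇒a≡c     : pa ≡ pc → a ≡ c
      pb≡pc⇒b≡c     : pb ≡ pc → b ≡ c

  extend-by-choice : (C : EdgeColouring G′ Port) → ∀ {a b c} →
                     (∀ j → N j → j ≡ a ⊎ j ≡ b ⊎ j ≡ c) → Choice C a b c → EdgeColouring G Port
  extend-by-choice C {a} {b} {c} covers ch = extend C f f-missing f-injective
    where
    open Choice ch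
    f : Fin n → Port
    f j with j Finₚ.≟ a | j Finₚ.≟ b
    ... | yes _ | _     = pa
    ... | no _  | yes _ = pb
    ... | no _  | no _  = pc

    Assigned : Fin n → Set
    Assigned j = (j ≡ a × f j ≡ pa) ⊎ (j ≡ b × f j ≡ pb) ⊎ (j ≡ c × f j ≡ pc)

    assigned : ∀ j → N j → Assigned j
    assigned j nj with j Finₚ.≟ a | j Finₚ.≟ b | covers j nj
    ... | yes j≡a | _       | _               = inj₁ (j≡a , refl)
    ... | no _    | yes j≡b | _               = inj₂ (inj₁ (j≡b , refl))
    ... | no j≢a  | no _    | inj₁ j≡a        = ⊥-elim (j≢a j≡a)
    ... | no _    | no j≢b  | inj₂ (inj₁ j≡b) = ⊥-elim (j≢b j≡b)
    ... | no _    | no _    | inj₂ (inj₂ j≡c) = inj₂ (inj₂ (j≡c , refl))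

    f-missing : ∀ j → N j → Missing C j (f j)
    f-missing j nj with assigned j nj
    ... | inj₁ (refl , e)        = subst (Missing C j) (sym e) a-misses
    ... | inj₂ (inj₁ (refl , e)) = subst (Missing C j) (sym e) b-misses
    ... | inj₂ (inj₂ (refl , e)) = subst (Missing C j) (sym e) c-misses

    same : ∀ {p q x y : Port} → p ≡ q → p ≡ x → q ≡ y → x ≡ y
    same e e₁ e₂ = trans (sym e₁) (trans e e₂)

    f-injective : ∀ j k → N j → N k → f j ≡ f k → j ≡ k
    f-injective j k nj nk e with assigned j nj | assigned k nk
    ... | inj₁ (refl , _)         | inj₁ (refl , _)         = refl
    ... | inj₂ (inj₁ (refl , _))  | inj₂ (inj₁ (refl , _))  = refl
    ... | inj₂ (inj₂ (refl , _))  | inj₂ (inj₂ (refl , _))  = refl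
    ... | inj₁ (refl , e₁)        | inj₂ (inj₁ (refl , e₂)) = pa≡pb⇒a≡b (same e e₁ e₂)
    ... | inj₁ (refl , e₁)        | inj₂ (inj₂ (refl , e₂)) = pa≡pc⇒a≡c (same e e₁ e₂)
    ... | inj₂ (inj₁ (refl , e₁)) | inj₂ (inj₂ (refl , e₂)) = pb≡pc⇒b≡c (same e e₁ e₂)
    ... | inj₂ (inj₁ (refl , e₁)) | inj₁ (refl , e₂)        = sym (pa≡pb⇒a≡b (sym (same e e₁ e₂)))
    ... | inj₂ (inj₂ (refl , e₁)) | inj₁ (refl , e₂)        = sym (pa≡pc⇒a≡c (sym (same e e₁ e₂)))
    ... | inj₂ (inj₂ (refl , e₁)) | inj₂ (inj₁ (refl , e₂)) = sym (pb≡pc⇒b≡c (sym (same e e₁ e₂)))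

  choice-of-distinct : ∀ {C a b c pa pb pc} → Missing C a pa → Missing C b pb → Missing C c pc →
                       pa ≢ pb → pa ≢ pc → pb ≢ pc → Choice C a b c
  choice-of-distinct ma mb mc pa≢pb pa≢pc pb≢pc = record
    { a-misses = ma ; b-misses = mb ; c-misses = mc
    ; pa≡pb⇒a≡b = ⊥-elim ∘ pa≢pb
    ; pa≡pc⇒a≡c = ⊥-elim ∘ pa≢pc
    ; pb≡pc⇒b≡c = ⊥-elim ∘ pb≢pc
    }

  -- a takes a colour p missing at a but used at b, so whatever b picks later differs from p.
  choice-via-b : (C : EdgeColouring G′ Port) → ∀ {a b c p} → N b → N c →
                 Missing C a p → Used C b p → Choice C a b c
  choice-via-b C nb nc ma ub with missing-avoiding C (two-missing-at-neighbour C nc) _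
  ... | pc , mc , pc≢p with missing-avoiding C (two-missing-at-neighbour C nb) pc
  ...   | pb , mb , pb≢pc = choice-of-distinct ma mb mc (used≢missing C ub mb) (pc≢p ∘ sym) pb≢pc

  choice-swap : ∀ {C a b c} → Choice C a b c → Choice C a c b
  choice-swap ch = record
    { a-misses = a-misses ; b-misses = c-misses ; c-misses = b-misses
    ; pa≡pb⇒a≡b = pa≡pc⇒a≡c
    ; pa≡pc⇒a≡c = pa≡pb⇒a≡b
    ; pb≡pc⇒b≡c = sym ∘ pb≡pc⇒b≡c ∘ sym
    }
    where open Choice ch

  choice-of-three : (C : EdgeColouring G′ Port) → ∀ {a b c} → b ≢ a → c ≢ a → b ≢ c → N a → N b → N c →
                    Σ[ C′ ∈ EdgeColouring G′ Port ] Choice C′ a b c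
  choice-of-three C {a} {b} {c} b≢a c≢a b≢c na nb nc with two-missing-at-neighbour C na
  ... | α , β , α≢β , mα , mβ
    with used? _≟ᵖ_ C b α | used? _≟ᵖ_ C b β | used? _≟ᵖ_ C c α | used? _≟ᵖ_ C c β
  ... | yes u | _     | _     | _     = C , choice-via-b C nb nc mα u
  ... | no _  | yes u | _     | _     = C , choice-via-b C nb nc mβ u
  ... | no _  | no _  | yes u | _     = C , choice-swap (choice-via-b C nc nb mα u)
  ... | no _  | no _  | no _  | yes u = C , choice-swap (choice-via-b C nc nb mβ u)
  -- Now b and c also miss α and β. Swapping the α/γ chain from a makes a miss γ, leaves β alone,
  -- and leaves α missing at one of b, c.
  ... | no mbα | no mbβ | no mcα | no mcβ with third-port α β
  ...   | γ , γ≢α , γ≢β with kempe-swap _≟ᵖ_ C {γ = γ} mα b≢a c≢a b≢c mbα mcα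
  ...     | C′ , aγ , preserved , inj₁ bα =
    C′ , choice-of-distinct aγ bα (preserved (α≢β ∘ sym) (γ≢β ∘ sym) mcβ) γ≢α γ≢β α≢β
  ...     | C′ , aγ , preserved , inj₂ cα =
    C′ , choice-of-distinct aγ (preserved (α≢β ∘ sym) (γ≢β ∘ sym) mbβ) cα γ≢β γ≢α (α≢β ∘ sym)

  extend-along : (C : EdgeColouring G′ Port) (xs : List (Fin n)) → Unique xs → All N xs →
                 (∀ j → N j → j ∈ xs) → length xs ≤ 3 → EdgeColouring G Port
  extend-along C [] _ _ complete _ =
    extend C (λ _ → up) (λ j nj → ⊥-elim (¬Any[] (complete j nj)))
                        (λ j _ nj _ _ → ⊥-elim (¬Any[] (complete j nj)))
  extend-along C (a ∷ []) _ (na ∷ []) complete _ with two-missing-at-neighbour C na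
  ... | α , _ , _ , mα , _ =
    extend-by-choice C (λ j nj → inj₁ (only (complete j nj)))
      (record { a-misses = mα ; b-misses = mα ; c-misses = mα
              ; pa≡pb⇒a≡b = λ _ → refl ; pa≡pc⇒a≡c = λ _ → refl ; pb≡pc⇒b≡c = λ _ → refl })
    where
    only : ∀ {j} → j ∈ a ∷ [] → j ≡ a
    only (here e) = e
  extend-along C (a ∷ b ∷ []) ((a≢b ∷ []) ∷ _) (na ∷ nb ∷ []) complete _ with two-missing-at-neighbour C na
  ... | α , _ , _ , mα , _ with missing-avoiding C (two-missing-at-neighbour C nb) α
  ...   | β , mβ , β≢α =
    extend-by-choice C (λ j nj → one-of (complete j nj))
      (record { a-misses = mα ; b-misses = mβ ; c-misses = mβ
              ; pa≡pb⇒a≡b = ⊥-elim ∘ β≢α ∘ sym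
              ; pa≡pc⇒a≡c = ⊥-elim ∘ β≢α ∘ sym
              ; pb≡pc⇒b≡c = λ _ → refl
              })
    where
    one-of : ∀ {j} → j ∈ a ∷ b ∷ [] → j ≡ a ⊎ j ≡ b ⊎ j ≡ b
    one-of (here e)         = inj₁ e
    one-of (there (here e)) = inj₂ (inj₁ e)
  extend-along C (a ∷ b ∷ c ∷ []) ((a≢b ∷ a≢c ∷ []) ∷ (b≢c ∷ []) ∷ _) (na ∷ nb ∷ nc ∷ []) complete _
    with choice-of-three C (a≢b ∘ sym) (a≢c ∘ sym) b≢c na nb nc
  ... | C′ , ch = extend-by-choice C′ (λ j nj → one-of (complete j nj)) ch
    where
    one-of : ∀ {j} → j ∈ a ∷ b ∷ c ∷ [] → j ≡ a ⊎ j ≡ b ⊎ j ≡ c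
    one-of (here e)                 = inj₁ e
    one-of (there (here e))         = inj₂ (inj₁ e)
    one-of (there (there (here e))) = inj₂ (inj₂ e)
  extend-along C (_ ∷ _ ∷ _ ∷ _ ∷ _) _ _ _ (s≤s (s≤s (s≤s ())))

  N? : ∀ j → Dec (N j)
  N? j = adj G zero (suc j) Boolₚ.≟ true

  neighbours₀ : List (Fin n)
  neighbours₀ = filter N? (allFin n)

  neighbours₀-unique : Unique neighbours₀
  neighbours₀-unique = Uniqueₚ.filter⁺ N? (Uniqueₚ.allFin⁺ n)

  neighbours₀-adjacent : All N neighbours₀
  neighbours₀-adjacent = All.tabulate (proj₂ ∘ ∈ₚ.∈-filter⁻ N? {xs = allFin n})

  extend-colouring : EdgeColouring G′ Port → EdgeColouring G Port
  extend-colouring C = extend-along C neighbours₀ neighbours₀-unique neighbours₀-adjacent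
    (λ j nj → ∈ₚ.∈-filter⁺ N? (∈ₚ.∈-allFin j) nj)
    (subst (_≤ 3) (length-map suc neighbours₀)
      (sub zero (map suc neighbours₀) (suc-unique neighbours₀-unique) (Allₚ.map⁺ neighbours₀-adjacent)))

subcubic-edge-colouring : ∀ n (G : Graph n) → Subcubic G → EdgeColouring G Port
subcubic-edge-colouring zero    G _   = record { colour = λ () ; colour-sym = λ () ; proper = λ () }
subcubic-edge-colouring (suc n) G sub =
  Extension.extend-colouring G sub (subcubic-edge-colouring n (delete₀ G) (delete₀-subcubic G sub))

-- Axis-parallel segments

-- across a is the coordinate that is constant on lines parallel to axis a, along a the one varying.
across along : Axis → Point → ℤ
across vertical   = xc
across horizontal = yc
along a = across (perp a)

point : Axis → ℤ → ℤ → Point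
point vertical   c ℓ = c , ℓ
point horizontal c ℓ = ℓ , c

across-point : ∀ a c ℓ → across a (point a c ℓ) ≡ c
across-point vertical   c ℓ = refl
across-point horizontal c ℓ = refl

along-point : ∀ a c ℓ → along a (point a c ℓ) ≡ ℓ
along-point vertical   c ℓ = refl
along-point horizontal c ℓ = refl

point-ext : ∀ a {q r} → across a q ≡ across a r → along a q ≡ along a r → q ≡ r
point-ext vertical   e e′ = cong₂ _,_ e e′
point-ext horizontal e e′ = cong₂ _,_ e′ e

Parallel : Axis → Segment → Set
Parallel a (p , q) = across a p ≡ across a q

parallel⇒axis : ∀ a {s} → Parallel a s → Horizontal s ⊎ Vertical s
parallel⇒axis horizontal e = inj₁ e
parallel⇒axis vertical   e = inj₂ e

parallel-perp⇒perpendicular : ∀ a {s t} → Parallel a s → Parallel (perp a) t → Perpendicular s t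
parallel-perp⇒perpendicular horizontal e e′ = inj₁ (e , e′)
parallel-perp⇒perpendicular vertical   e e′ = inj₂ (e , e′)

perpendicular-sym : ∀ {s t} → Perpendicular s t → Perpendicular t s
perpendicular-sym (inj₁ (h , v)) = inj₂ (v , h)
perpendicular-sym (inj₂ (v , h)) = inj₁ (h , v)

≢⇒perp : ∀ {a b} → a ≢ b → b ≡ perp a
≢⇒perp {horizontal} {horizontal} a≢b = ⊥-elim (a≢b refl)
≢⇒perp {horizontal} {vertical}   _   = refl
≢⇒perp {vertical}   {horizontal} _   = refl
≢⇒perp {vertical}   {vertical}   a≢b = ⊥-elim (a≢b refl)

perp-injective : ∀ {a b} → perp a ≡ perp b → a ≡ b
perp-injective {horizontal} {horizontal} _ = refl
perp-injective {vertical}   {vertical}   _ = refl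

between-sym : ∀ {x y z} → Between x y z → Between z y x
between-sym (inj₁ (x≤y , y≤z)) = inj₂ (x≤y , y≤z)
between-sym (inj₂ (z≤y , y≤x)) = inj₁ (z≤y , y≤x)

between-self : ∀ {x y} → Between x y x → y ≡ x
between-self (inj₁ (x≤y , y≤x)) = ℤP.≤-antisym y≤x x≤y
between-self (inj₂ (x≤y , y≤x)) = ℤP.≤-antisym y≤x x≤y

on-vertical : ∀ {p q r} → Vertical (p , q) → OnSeg r (p , q) → xc r ≡ xc p × Between (yc p) (yc r) (yc q)
on-vertical _ (inj₁ (e , _ , btw)) = e , btw
on-vertical {p} {q} {r} e (inj₂ (e₁ , e₂ , btw)) =
  between-self (subst (Between (xc p) (xc r)) (sym e) btw) ,
  inj₁ (ℤP.≤-reflexive (sym e₁) , ℤP.≤-reflexive e₂)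

on-horizontal : ∀ {p q r} → Horizontal (p , q) → OnSeg r (p , q) → yc r ≡ yc p × Between (xc p) (xc r) (xc q)
on-horizontal {p} {q} {r} e (inj₁ (e₁ , e₂ , btw)) =
  between-self (subst (Between (yc p) (yc r)) (sym e) btw) ,
  inj₁ (ℤP.≤-reflexive (sym e₁) , ℤP.≤-reflexive e₂)
on-horizontal _ (inj₂ (e , _ , btw)) = e , btw

on-parallel : ∀ a {p q r} → Parallel a (p , q) → OnSeg r (p , q) →
              across a r ≡ across a p × Between (along a p) (along a r) (along a q)
on-parallel vertical   = on-vertical
on-parallel horizontal = on-horizontal

Toward Past : Side → ℤ → ℤ → Set
Toward low  x y = y ℤ.≤ x
Toward high x y = x ℤ.≤ y
Past   low  x y = y ℤ.< x
Past   high x y = x ℤ.< y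

past⇒toward : ∀ s {x y} → Past s x y → Toward s x y
past⇒toward low  = ℤP.<⇒≤
past⇒toward high = ℤP.<⇒≤

past⇒≢ : ∀ s {x y} → Past s x y → x ≢ y
past⇒≢ low  y<x = ℤP.<⇒≢ y<x ∘ sym
past⇒≢ high x<y = ℤP.<⇒≢ x<y

toward-between : ∀ s {x y z} → Toward s x z → Between x y z → Toward s x y
toward-between low  z≤x (inj₁ (x≤y , y≤z)) = ℤP.≤-trans y≤z z≤x
toward-between low  z≤x (inj₂ (z≤y , y≤x)) = y≤x
toward-between high x≤z (inj₁ (x≤y , y≤z)) = x≤y
toward-between high x≤z (inj₂ (z≤y , y≤x)) = ℤP.≤-trans x≤z z≤y

toward-opposite : ∀ {s s′ x y} → s ≢ s′ → Toward s x y → Toward s′ x y → y ≡ x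
toward-opposite {low}  {low}  s≢s′ _ _ = ⊥-elim (s≢s′ refl)
toward-opposite {low}  {high} _ y≤x x≤y = ℤP.≤-antisym y≤x x≤y
toward-opposite {high} {low}  _ x≤y y≤x = ℤP.≤-antisym y≤x x≤y
toward-opposite {high} {high} s≢s′ _ _ = ⊥-elim (s≢s′ refl)

past-opposite : ∀ {s s′ x y z} → s ≢ s′ → Past s x y → Past s′ x z → y ≢ z
past-opposite {low}  {low}  s≢s′ _ _ = ⊥-elim (s≢s′ refl)
past-opposite {low}  {high} _ y<x x<z = ℤP.<⇒≢ (ℤP.<-trans y<x x<z)
past-opposite {high} {low}  _ x<y z<x = ℤP.<⇒≢ (ℤP.<-trans z<x x<y) ∘ sym
past-opposite {high} {high} s≢s′ _ _ = ⊥-elim (s≢s′ refl)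

OnLine : Axis → ℤ → Segment → Set
OnLine a c s = Parallel a s × (∀ q → OnSeg q s → across a q ≡ c)

crossing-lines : ∀ a {c c′ s t} → OnLine a c s → OnLine (perp a) c′ t →
                 Perpendicular s t × (∀ q r → OnSeg q s → OnSeg q t → OnSeg r s → OnSeg r t → q ≡ r)
crossing-lines a (∥s , on-s) (∥t , on-t) =
  parallel-perp⇒perpendicular a ∥s ∥t ,
  λ q r qs qt rs rt → point-ext a (trans (on-s q qs) (sym (on-s r rs))) (trans (on-t q qt) (sym (on-t r rt)))

parallel-lines-disjoint : ∀ a {c c′ s t} → OnLine a c s → OnLine a c′ t → c ≢ c′ →
                          ∀ q → OnSeg q s → OnSeg q t → ⊥
parallel-lines-disjoint a (_ , on-s) (_ , on-t) c≢c′ q qs qt = c≢c′ (trans (sym (on-s q qs)) (on-t q qt))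

-- Routing the edges of a 4-edge-coloured graph

InRange : ℕ → ℤ → Set
InRange m c = + 1 ℤ.≤ c × c ℤ.≤ + m

module Routing {n} (G : Graph n) (C : EdgeColouring G Port) (m : ℕ) (pos : Fin n → Point)
               (pos-in-range : ∀ a v → InRange m (across a (pos v)))
               (pos-injective : ∀ a {u v} → across a (pos u) ≡ across a (pos v) → u ≡ v) where

  beyond : Side → ℤ → ℤ
  beyond low  d = - d
  beyond high d = + m ℤ.+ d

  beyond-past : ∀ s {c d} → InRange m c → + 1 ℤ.≤ d → Past s c (beyond s d)
  beyond-past low  (1≤c , _) 1≤d = ℤP.≤-<-trans (ℤP.neg-mono-≤ 1≤d) (ℤP.<-≤-trans ℤ.-<+ 1≤c)
  beyond-past high {d = d} (_ , c≤m) 1≤d =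
    ℤP.≤-<-trans c≤m (subst (ℤ._< + m ℤ.+ d) (ℤP.+-identityʳ (+ m))
                            (ℤP.+-monoʳ-< (+ m) (ℤP.<-≤-trans (ℤ.+<+ (ℕ.s≤s ℕ.z≤n)) 1≤d)))

  beyond-injective : ∀ s {d d′} → beyond s d ≡ beyond s d′ → d ≡ d′
  beyond-injective low  = ℤP.neg-injective
  beyond-injective high = ∙-cancelˡ (+ m) _ _

  level : Port → Fin n → Fin n → ℤ
  level (a , s) u v = beyond s (across a (pos u) ⊓ across a (pos v))

  level-sym : ∀ p u v → level p v u ≡ level p u v
  level-sym (a , s) u v = cong (beyond s) (ℤP.⊓-comm (across a (pos v)) (across a (pos u)))

  level-past : ∀ {c} a s u v → InRange m c → Past s c (level (a , s) u v)
  level-past a s u v c∈ = beyond-past s c∈ (ℤP.⊓-glb (proj₁ (pos-in-range a u)) (proj₁ (pos-in-range a v)))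

  min-at-end : ∀ a u v → ∃[ w ] Ends u v w × across a (pos u) ⊓ across a (pos v) ≡ across a (pos w)
  min-at-end a u v with ℤP.⊓-sel (across a (pos u)) (across a (pos v))
  ... | inj₁ e = u , inj₁ refl , e
  ... | inj₂ e = v , inj₂ refl , e

  bends : Port → Fin n → Fin n → List Point
  bends (a , s) u v = point a (across a (pos u)) (level (a , s) u v)
                    ∷ point a (across a (pos v)) (level (a , s) u v) ∷ []

  path : Port → Fin n → Fin n → List Point
  path p u v = pos u ∷ bends p u v ++ [ pos v ]

  bends-sym : ∀ p u v → bends p v u ≡ reverse (bends p u v)
  bends-sym p@(a , s) u v rewrite level-sym p u v = refl

  data Piece (u v : Fin n) : Port → Segment → Set where
    ray    : ∀ {a s seg} w → Ends u v w → OnLine a (across a (pos w)) seg →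
             (∀ q → OnSeg q seg → Toward s (along a (pos w)) (along a q)) → Piece u v (a , s) seg
    bridge : ∀ {a s seg} → OnLine (perp a) (level (a , s) u v) seg → Piece u v (a , s) seg

  module Legs (a : Axis) (s : Side) (u v : Fin n) where
    ℓ : ℤ
    ℓ = level (a , s) u v
    b₁ b₂ : Point
    b₁ = point a (across a (pos u)) ℓ
    b₂ = point a (across a (pos v)) ℓ

    first-∥ : Parallel a (pos u , b₁)
    first-∥ = sym (across-point a _ ℓ)

    bridge-∥ : Parallel (perp a) (b₁ , b₂)
    bridge-∥ = trans (along-point a _ ℓ) (sym (along-point a _ ℓ))

    last-∥ : Parallel a (b₂ , pos v)
    last-∥ = across-point a _ ℓ

    ray-piece : ∀ {w seg} → Ends u v w → Parallel a seg →
                (∀ {q} → OnSeg q seg → across a q ≡ across a (pos w) × Between (along a (pos w)) (along a q) ℓ) →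
                Piece u v (a , s) seg
    ray-piece {w} ends ∥ on = ray w ends (∥ , λ _ → proj₁ ∘ on)
      λ _ → toward-between s (past⇒toward s (level-past a s u v (pos-in-range (perp a) w))) ∘ proj₂ ∘ on

    first-piece : Piece u v (a , s) (pos u , b₁)
    first-piece = ray-piece (inj₁ refl) first-∥ λ on →
      let e , btw = on-parallel a first-∥ on in e , subst (Between _ _) (along-point a _ ℓ) btw

    bridge-piece : Piece u v (a , s) (b₁ , b₂)
    bridge-piece =
      bridge (bridge-∥ , λ _ on → trans (proj₁ (on-parallel (perp a) bridge-∥ on)) (along-point a _ ℓ))

    last-piece : Piece u v (a , s) (b₂ , pos v)
    last-piece = ray-piece (inj₂ refl) last-∥ λ on →
      let e , btw = on-parallel a last-∥ on
      in trans e (across-point a _ ℓ) , between-sym (subst (λ z → Between z _ _) (along-point a _ ℓ) btw)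

  pieces : ∀ p u v {seg} → seg ∈ segs (path p u v) → Piece u v p seg
  pieces (a , s) u v (here refl)                 = Legs.first-piece a s u v
  pieces (a , s) u v (there (here refl))         = Legs.bridge-piece a s u v
  pieces (a , s) u v (there (there (here refl))) = Legs.last-piece a s u v

  lineAxis : ∀ {u v p seg} → Piece u v p seg → Axis
  lineAxis (ray {a} _ _ _ _) = a
  lineAxis (bridge {a} _)    = perp a

  lineOffset : ∀ {u v p seg} → Piece u v p seg → ℤ
  lineOffset         (ray {a} w _ _ _)   = across a (pos w)
  lineOffset {u} {v} (bridge {a} {s} _)  = level (a , s) u v

  piece-on-line : ∀ {u v p seg} (P : Piece u v p seg) → OnLine (lineAxis P) (lineOffset P) seg
  piece-on-line (ray _ _ L _) = L
  piece-on-line (bridge L)    = L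

  data Meeting (s t : Segment) : Set where
    crossing  : Perpendicular s t → (∀ q r → OnSeg q s → OnSeg q t → OnSeg r s → OnSeg r t → q ≡ r) →
                Meeting s t
    at-vertex : ∀ w → (∀ q → OnSeg q s → OnSeg q t → q ≡ pos w) → Meeting s t
    apart     : (∀ q → OnSeg q s → OnSeg q t → ⊥) → Meeting s t

  module TwoEdges {u v u′ v′} (uv : Adj G u v) (u′v′ : Adj G u′ v′) (¬same : ¬ SameEdge u v u′ v′) where

    ends-apart : ∀ a {w w′} → Ends u v w → Ends u′ v′ w′ → colour C u v ≡ colour C u′ v′ →
                 across a (pos w) ≢ across a (pos w′)
    ends-apart a ends ends′ c e =
      shared-endpoint⇒colours-differ C uv u′v′ ¬same ends
        (subst (Ends u′ v′) (sym (pos-injective a e)) ends′) c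

    levels-differ : ∀ {a s s′} → colour C u v ≡ (a , s) → colour C u′ v′ ≡ (a , s′) →
                    level (a , s) u v ≢ level (a , s′) u′ v′
    levels-differ {a} {s} {s′} c c′ e with s ≟ˢ s′
    ... | no s≢s′ =
      past-opposite s≢s′ (level-past a s u v (pos-in-range a u)) (level-past a s′ u′ v′ (pos-in-range a u)) e
    ... | yes refl with min-at-end a u v | min-at-end a u′ v′
    ...   | w , ends , min≡ | w′ , ends′ , min≡′ =
      ends-apart a ends ends′ (trans c (sym c′)) (trans (sym min≡) (trans (beyond-injective s e) min≡′))

    coincident : ∀ {p p′ seg seg′} → colour C u v ≡ p → colour C u′ v′ ≡ p′ →
                 (P : Piece u v p seg) (Q : Piece u′ v′ p′ seg′) →
                 lineAxis P ≡ lineAxis Q → lineOffset P ≡ lineOffset Q → Meeting seg seg′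
    coincident c c′ (ray {a} {s} w ends (_ , on) toward) (ray {s = s′} w′ ends′ (_ , on′) toward′) refl e
      with s ≟ˢ s′
    ... | yes refl = ⊥-elim (ends-apart a ends ends′ (trans c (sym c′)) e)
    ... | no s≢s′ with pos-injective a e
    ...   | refl = at-vertex w λ q qs qt →
      point-ext a (on q qs) (toward-opposite s≢s′ (toward q qs) (toward′ q qt))
    coincident _ _ (ray {a} w _ _ _) (bridge {a′} {s′} _) _ e =
      ⊥-elim (past⇒≢ s′ (level-past a′ s′ u′ v′ (pos-in-range a w)) e)
    coincident _ _ (bridge {a} {s} _) (ray {a′} w′ _ _ _) _ e =
      ⊥-elim (past⇒≢ s (level-past a s u v (pos-in-range a′ w′)) (sym e))
    coincident c c′ (bridge _) (bridge _) ax e with perp-injective ax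
    ... | refl = ⊥-elim (levels-differ c c′ e)

    meeting : ∀ {p p′ seg seg′} → colour C u v ≡ p → colour C u′ v′ ≡ p′ →
              Piece u v p seg → Piece u′ v′ p′ seg′ → Meeting seg seg′
    meeting c c′ P Q with lineAxis P ≟ᵃ lineAxis Q
    ... | no ax≢ = uncurry crossing
          (crossing-lines (lineAxis P) (piece-on-line P)
                          (subst (λ b → OnLine b (lineOffset Q) _) (≢⇒perp ax≢) (piece-on-line Q)))
    ... | yes ax≡ with lineOffset P ℤ.≟ lineOffset Q
    ...   | no off≢ = apart (parallel-lines-disjoint (lineAxis P) (piece-on-line P)
                               (subst (λ b → OnLine b (lineOffset Q) _) (sym ax≡) (piece-on-line Q)) off≢)
    ...   | yes off≡ = coincident c c′ P Q ax≡ off≡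

  meeting⇒¬overlap : ∀ {s t} → Meeting s t → ¬ Overlap s t
  meeting⇒¬overlap (crossing _ unique) (q , r , q≢r , qs , qt , rs , rt) = q≢r (unique q r qs qt rs rt)
  meeting⇒¬overlap (at-vertex _ at)    (q , r , q≢r , qs , qt , rs , rt) =
    q≢r (trans (at q qs qt) (sym (at r rs rt)))
  meeting⇒¬overlap (apart disjoint)    (q , _ , _ , qs , qt , _) = disjoint q qs qt

  meeting⇒right-angle : ∀ {s t} → Meeting s t → ∀ q → OnSeg q s → OnSeg q t → (∀ w → pos w ≢ q) →
                        Perpendicular s t
  meeting⇒right-angle (crossing ⊥st _) _ _  _  _   = ⊥st
  meeting⇒right-angle (at-vertex w at) q qs qt off = ⊥-elim (off w (sym (at q qs qt)))
  meeting⇒right-angle (apart disjoint) q qs qt _   = ⊥-elim (disjoint q qs qt)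

  piece-avoids : ∀ {p u v w seg} → ¬ Ends u v w → Piece u v p seg → ¬ OnSeg (pos w) seg
  piece-avoids ¬ends (ray {a} _ ends (_ , on) _) o = ¬ends (subst (Ends _ _) (sym (pos-injective a (on _ o))) ends)
  piece-avoids {w = w} _ (bridge {a} {s} (_ , on)) o =
    past⇒≢ s (level-past a s _ _ (pos-in-range (perp a) w)) (on _ o)

  path-nondegenerate : ∀ p u v → u ≢ v → ∀ {x y} → (x , y) ∈ segs (path p u v) → x ≢ y
  path-nondegenerate (a , s) u v _ (here refl) e =
    past⇒≢ s (level-past a s u v (pos-in-range (perp a) u)) (trans (cong (along a) e) (along-point a _ _))
  path-nondegenerate (a , s) u v u≢v (there (here refl)) e =
    u≢v (pos-injective a (trans (sym (across-point a _ _)) (trans (cong (across a) e) (across-point a _ _))))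
  path-nondegenerate (a , s) u v _ (there (there (here refl))) e =
    past⇒≢ s (level-past a s u v (pos-in-range (perp a) v)) (trans (sym (cong (along a) e)) (along-point a _ _))

  path-turns : ∀ p u v → Turns (path p u v)
  path-turns (a , s) u v =
    parallel-perp⇒perpendicular a first-∥ bridge-∥ ,
    perpendicular-sym (parallel-perp⇒perpendicular a last-∥ bridge-∥) , tt
    where open Legs a s u v

  bends-length : ∀ p u v → length (bends p u v) ≡ 2
  bends-length (a , s) u v = refl

  route : Fin n → Fin n → List Point
  route u v = bends (colour C u v) u v

  route-sym : ∀ u v → Adj G u v → route v u ≡ reverse (route u v)
  route-sym u v uv rewrite colour-sym C v u (Adj-sym G uv) = bends-sym (colour C u v) u v

  embedding : RestrictedRAC2 G pos
  embedding = record
    { route       = route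
    ; route-sym   = route-sym
    ; two-bends   = λ u v _ → ℕP.≤-reflexive (bends-length (colour C u v) u v)
    ; axis        = λ u v uv (x , y) seg∈ →
        path-nondegenerate (colour C u v) u v (Adj-irrefl G uv) seg∈ , on-axis (pieces (colour C u v) u v seg∈)
    ; genuine     = λ u v _ → path-turns (colour C u v) u v
    ; avoid       = λ u v _ w w≢u w≢v _ seg∈ →
        piece-avoids (Sum.[ w≢u , w≢v ]) (pieces (colour C u v) u v seg∈)
    ; no-overlap  = λ u v u′ v′ uv u′v′ ¬same _ _ s∈ t∈ →
        meeting⇒¬overlap (meeting-of uv u′v′ ¬same s∈ t∈)
    ; right-angle = λ u v u′ v′ uv u′v′ ¬same _ _ s∈ t∈ →
        meeting⇒right-angle (meeting-of uv u′v′ ¬same s∈ t∈)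
    }
    where
    on-axis : ∀ {u v p seg} → Piece u v p seg → Horizontal seg ⊎ Vertical seg
    on-axis P = parallel⇒axis (lineAxis P) (proj₁ (piece-on-line P))
    meeting-of : ∀ {u v u′ v′ s t} → Adj G u v → Adj G u′ v′ → ¬ SameEdge u v u′ v′ →
                 s ∈ segs (path (colour C u v) u v) → t ∈ segs (path (colour C u′ v′) u′ v′) → Meeting s t
    meeting-of {u} {v} {u′} {v′} uv u′v′ ¬same s∈ t∈ =
      TwoEdges.meeting uv u′v′ ¬same refl refl
        (pieces (colour C u v) u v s∈) (pieces (colour C u′ v′) u′ v′ t∈)

placement-in-range : ∀ {n} (S : GridPointSet n) (f : Fin n → Fin n) → ∀ a v → InRange n (across a (pt S (f v)))
placement-in-range S f vertical   v = x-range S (f v)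
placement-in-range S f horizontal v = y-range S (f v)

placement-injective : ∀ {n} (S : GridPointSet n) {f : Fin n → Fin n} → (∀ {u v} → f u ≡ f v → u ≡ v) →
                      ∀ a {u v} → across a (pt S (f u)) ≡ across a (pt S (f v)) → u ≡ v
placement-injective S f-inj vertical   e = f-inj (x-inj S _ _ e)
placement-injective S f-inj horizontal e = f-inj (y-inj S _ _ e)

theorem4 : (n : ℕ) (G : Graph n) → MaxDegree≤3 G →
           (S : GridPointSet n) (μ : Fin n ⤖ Fin n) →
           MuRespectingRAC2 G S μ
theorem4 n G Δ≤3 S μ =
  Routing.embedding G colouring n (λ v → pt S (to v))
    (placement-in-range S to) (placement-injective S injective)
  where
  open Bijection μ using (to; injective)
  colouring : EdgeColouring G Port
  colouring = subcubic-edge-colouring n G (maxDegree≤3⇒subcubic G Δ≤3)
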